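{- For every integer $n\ge 1$ we have $CGD(n)=1$, and for all positive integers $n,t$, $$CGD(n,t)=\begin{cases}1 & \text{if } t=1,\ n=1,\\ 1 & \text{if } t=2,\ n\ge 2,\\ 0 & \text{otherwise}.\end{cases}$$
   Context: A simple game is a pair $(N,W)$ with $N=\{1,\dots,n\}$ and $W$ a family of subsets of $N$ (the winning coalitions) such that $N\in W$, $\emptyset\notin W$, and $S\in W$, $S\subseteq T\subseteq N$ imply $T\in W$. $W^m$ denotes the set of inclusion-minimal winning coalitions. Players $i,j$ are equally desirable ($i\approx j$) if $S\cup\{i\}\in W\iff S\cup\{j\}\in W$ for all $S\subseteq N\setminus\{i,j\}$; $i$ is at least as desirable as $j$ ($i\succsim j$) if $S\cup\{j\}\in W\Rightarrow S\cup\{i\}\in W$ for all $S\subseteq N\setminus\{i,j\}$. The game is complete if $\succsim$ is a complete preorder on $N$. The number of types $t$ of a game is the number of equivalence classes of $\approx$. Two simple games $(N,W),(N',W')$ are isomorphic if there is a bijection $f:N\to N'$ with $S\in W\iff f(S)\in W'$. A player $i$ is a dictator if $W^m=\{\{i\}\}$. $CGD(n)$ denotes the number of isomorphism classes of complete simple games with $n$ players containing a dictator, and $CGD(n,t)$ the number of those with exactly $t$ types. -}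

module Defs where

open import Data.Nat using (ℕ; zero; suc)
open import Data.Bool using (Bool; true; false)
open import Data.Fin using (Fin)
open import Data.Fin.Subset using (Subset; _∈_; _∉_; _⊆_; _∪_; ⁅_⁆) renaming (⊤ to Full; ⊥ to Empty)
open import Data.Vec using (tabulate; lookup)
open import Data.Product using (Σ; _×_; ∃)
open import Data.Sum using (_⊎_)
open import Relation.Binary.PropositionalEquality using (_≡_; _≢_)
open import Relation.Nullary using (¬_)
open import Function.Bundles using (_↔_; _⇔_; Inverse)
open import Function.Definitions using (Surjective)

record SimpleGame (n : ℕ) : Set where
  field
    W         : Subset n → Bool
    full-win  : W Full ≡ true
    empty-los : W Empty ≡ false
    monotone  : ∀ S T → W S ≡ true → S ⊆ T → W T ≡ true
open SimpleGame public

Winning : ∀ {n} → SimpleGame n → Subset n → Set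
Winning G S = W G S ≡ true

MinWinning : ∀ {n} → SimpleGame n → Subset n → Set
MinWinning G S = Winning G S × (∀ T → T ⊆ S → T ≢ S → ¬ Winning G T)

Dictator : ∀ {n} → SimpleGame n → Fin n → Set
Dictator G i = ∀ S → MinWinning G S ⇔ (S ≡ ⁅ i ⁆)

HasDictator : ∀ {n} → SimpleGame n → Set
HasDictator G = ∃ λ i → Dictator G i

EquallyDesirable : ∀ {n} → SimpleGame n → Fin n → Fin n → Set
EquallyDesirable G i j =
  ∀ S → i ∉ S → j ∉ S → (Winning G (S ∪ ⁅ i ⁆) ⇔ Winning G (S ∪ ⁅ j ⁆))

AtLeastAsDesirable : ∀ {n} → SimpleGame n → Fin n → Fin n → Set
AtLeastAsDesirable G i j =
  ∀ S → i ∉ S → j ∉ S → Winning G (S ∪ ⁅ j ⁆) → Winning G (S ∪ ⁅ i ⁆)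

Complete : ∀ {n} → SimpleGame n → Set
Complete G =
  (∀ i → AtLeastAsDesirable G i i)
  × (∀ i j k → AtLeastAsDesirable G i j → AtLeastAsDesirable G j k → AtLeastAsDesirable G i k)
  × (∀ i j → AtLeastAsDesirable G i j ⊎ AtLeastAsDesirable G j i)

-- the game has exactly t types: ≈ has exactly t equivalence classes, i.e. there is a
-- surjection N → Fin t whose fibres are exactly the ≈-classes.
NumTypes : ∀ {n} → SimpleGame n → ℕ → Set
NumTypes {n} G t =
  Σ (Fin n → Fin t) λ f →
    Surjective _≡_ _≡_ f × (∀ i j → EquallyDesirable G i j ⇔ (f i ≡ f j))

image : ∀ {n m} → (Fin n ↔ Fin m) → Subset n → Subset m
image f S = tabulate (λ j → lookup S (Inverse.from f j))

Isomorphic : ∀ {n m} → SimpleGame n → SimpleGame m → Set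
Isomorphic {n} {m} G H =
  Σ (Fin n ↔ Fin m) λ f → ∀ S → Winning G S ⇔ Winning H (image f S)

NumIsoClasses : (n : ℕ) → (SimpleGame n → Set) → ℕ → Set
NumIsoClasses n P k =
  Σ (Fin k → SimpleGame n) λ g →
    (∀ a → P (g a))
    × (∀ a b → Isomorphic (g a) (g b) → a ≡ b)
    × (∀ G → P G → ∃ λ a → Isomorphic G (g a))

CompleteWithDictator : ∀ {n} → SimpleGame n → Set
CompleteWithDictator G = Complete G × HasDictator G

cgdValue : ℕ → ℕ → ℕ
cgdValue 1 1 = 1
cgdValue (suc (suc _)) 2 = 1
cgdValue _ _ = 0

module Submission where

-- In a game with dictator i a coalition wins exactly when it contains i: below
-- any winning S lies a minimal winning coalition, and it must be ⁅ i ⁆. So the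
-- game is determined by i, and two such games are isomorphic via the
-- transposition of their dictators. Moreover a is at least as desirable as b
-- iff (b is the dictator ⇒ a is): a complete preorder with one class for n = 1
-- and two (dictator, dummies) for n ≥ 2. The number of types is well defined
-- because two surjections with the same kernel have codomains of equal size.

open import Data.Nat using (ℕ; zero; suc; _≤_)
import Data.Nat.Properties as ℕ
open import Data.Bool using (Bool; true; false; _∨_)
import Data.Bool as Bool
import Data.Bool.Properties as Boolₚ
open import Data.Fin using (Fin; zero; suc; _≟_; punchIn)
open import Data.Fin.Properties using (injective⇒≤; 2↔Bool; punchInᵢ≢i)
import Data.Fin.Permutation as Perm
import Data.Fin.Permutation.Components as PermC
open import Data.Fin.Subset
  using (Subset; outside; inside; _∈_; _⊆_; _∪_; ⁅_⁆) renaming (⊥ to Empty)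
open import Data.Fin.Subset.Properties
  using (out⊆; s⊆s; drop-∷-⊆; ⊆-refl; ⊆-trans; ⊆-antisym; ∉⊥; x∈⁅x⁆; x∈⁅y⁆⇒x≡y)
open import Data.Vec using ([]; _∷_; here; lookup)
open import Data.Vec.Properties
  using ([]=⇒lookup; lookup⇒[]=; lookup-zipWith; lookup-replicate; lookup∘tabulate; ≡-dec)
open import Data.Product using (_×_; _,_; proj₁; proj₂; ∃)
open import Data.Sum using (map)
open import Function using (_∘_)
open import Function.Bundles using (_⇔_; mk⇔; Equivalence; Bijection)
open import Function.Definitions using (Surjective)
open import Function.Properties.Inverse using (↔-sym; ↔⇒⤖)
import Function.Construct.Composition as Composition
open import Relation.Binary.PropositionalEquality
  using (_≡_; _≢_; refl; sym; trans; cong; subst; _≗_; module ≡-Reasoning)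
open import Relation.Nullary using (¬_; yes; no; contradiction)
open import Relation.Nullary.Decidable using (dec-true; decidable-stable)

open import Defs

open Equivalence using (to; from)

≡⇒true⇔true : ∀ {x y : Bool} → x ≡ y → (x ≡ true ⇔ y ≡ true)
≡⇒true⇔true x≡y = mk⇔ (trans (sym x≡y)) (trans x≡y)

Monotone : ∀ {n} → (Subset n → Bool) → Set
Monotone P = ∀ S T → P S ≡ true → S ⊆ T → P T ≡ true

Minimal : ∀ {n} → (Subset n → Bool) → Subset n → Set
Minimal P T = P T ≡ true × (∀ U → U ⊆ T → U ≢ T → ¬ P U ≡ true)

module _ {n} {P : Subset (suc n) → Bool} where

  monotone-∷ : Monotone P → ∀ s → Monotone (P ∘ (s ∷_))
  monotone-∷ mono s S T PS S⊆T = mono _ _ PS (s⊆s S⊆T)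

  minimal-outside : ∀ {T} → Minimal (P ∘ (outside ∷_)) T → Minimal P (outside ∷ T)
  minimal-outside (PT , below) = PT , λ where
    (outside ∷ U) U⊆T U≢T → below U (drop-∷-⊆ U⊆T) (U≢T ∘ cong (outside ∷_))
    (inside ∷ U) U⊆T → contradiction (U⊆T here) λ ()

  minimal-inside : Monotone P → ∀ {T} → ¬ P (outside ∷ T) ≡ true →
                   Minimal (P ∘ (inside ∷_)) T → Minimal P (inside ∷ T)
  minimal-inside mono ¬P[out∷T] (PT , below) = PT , λ where
    (inside ∷ U) U⊆T U≢T → below U (drop-∷-⊆ U⊆T) (U≢T ∘ cong (inside ∷_))
    (outside ∷ U) U⊆T _ PU → ¬P[out∷T] (mono _ _ PU (s⊆s (drop-∷-⊆ U⊆T)))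

minimal-⊆ : ∀ {n} {P : Subset n → Bool} → Monotone P →
            ∀ {S} → P S ≡ true → ∃ λ T → T ⊆ S × Minimal P T
minimal-⊆ {zero} _ {[]} PS = [] , ⊆-refl , PS , λ { [] _ []≢[] → contradiction refl []≢[] }
minimal-⊆ mono {outside ∷ S} PS
  with T , T⊆S , minT ← minimal-⊆ (monotone-∷ mono outside) PS
  = outside ∷ T , s⊆s T⊆S , minimal-outside minT
minimal-⊆ {P = P} mono {inside ∷ S} PS with P (outside ∷ S) in P[out∷S]
... | true with T , T⊆S , minT ← minimal-⊆ mono P[out∷S]
  = T , ⊆-trans T⊆S (out⊆ ⊆-refl) , minT
... | false with T , T⊆S , minT ← minimal-⊆ (monotone-∷ mono inside) PS
  = inside ∷ T , s⊆s T⊆S , minimal-inside mono ¬P[out∷T] minT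
  where
  ¬P[out∷T] : ¬ P (outside ∷ T) ≡ true
  ¬P[out∷T] P[out∷T] with () ← trans (sym (mono _ _ P[out∷T] (s⊆s T⊆S))) P[out∷S]

⁅⁆⊆ : ∀ {n} {i : Fin n} {S} → i ∈ S → ⁅ i ⁆ ⊆ S
⁅⁆⊆ {i = i} i∈S j∈⁅i⁆ = subst (_∈ _) (sym (x∈⁅y⁆⇒x≡y i j∈⁅i⁆)) i∈S

Dictatorship : ∀ {n} → SimpleGame n → Fin n → Set
Dictatorship G i = W G ≗ λ S → lookup S i

module _ {n} (G : SimpleGame n) {i : Fin n} (dictator : Dictator G i) where

  dictator-winning : Winning G ⁅ i ⁆
  dictator-winning = proj₁ (from (dictator ⁅ i ⁆) refl)

  winning⇒dictator∈ : ∀ {S} → Winning G S → i ∈ S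
  winning⇒dictator∈ WS with T , T⊆S , minT ← minimal-⊆ (monotone G) WS =
    T⊆S (subst (i ∈_) (sym (to (dictator T) minT)) (x∈⁅x⁆ i))

  dictator⇒dictatorship : Dictatorship G i
  dictator⇒dictatorship S with lookup S i in i?S
  ... | true = monotone G _ _ dictator-winning (⁅⁆⊆ (lookup⇒[]= i S i?S))
  ... | false = Boolₚ.¬-not λ WS →
    contradiction (trans (sym ([]=⇒lookup (winning⇒dictator∈ WS))) i?S) λ ()

module _ {n} (G : SimpleGame n) {i : Fin n} (dictatorship : Dictatorship G i) where

  winning⇔dictator∈ : ∀ S → Winning G S ⇔ i ∈ S
  winning⇔dictator∈ S = mk⇔
    (λ WS → lookup⇒[]= i S (trans (sym (dictatorship S)) WS))
    (λ i∈S → trans (dictatorship S) ([]=⇒lookup i∈S))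

  dictatorship⇒dictator : Dictator G i
  dictatorship⇒dictator S = mk⇔ minimal⇒⁅i⁆ λ { refl → ⁅i⁆-minimal }
    where
    ⁅i⁆-winning : Winning G ⁅ i ⁆
    ⁅i⁆-winning = from (winning⇔dictator∈ ⁅ i ⁆) (x∈⁅x⁆ i)

    minimal⇒⁅i⁆ : MinWinning G S → S ≡ ⁅ i ⁆
    minimal⇒⁅i⁆ (WS , below) = decidable-stable (≡-dec Boolₚ._≟_ S ⁅ i ⁆) λ S≢⁅i⁆ →
      below ⁅ i ⁆ (⁅⁆⊆ (to (winning⇔dictator∈ S) WS)) (S≢⁅i⁆ ∘ sym) ⁅i⁆-winning

    ⁅i⁆-minimal : MinWinning G ⁅ i ⁆
    ⁅i⁆-minimal = ⁅i⁆-winning , λ U U⊆⁅i⁆ U≢⁅i⁆ WU →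
      U≢⁅i⁆ (⊆-antisym U⊆⁅i⁆ (⁅⁆⊆ (to (winning⇔dictator∈ U) WU)))

  playerType : Fin n → Bool
  playerType a = lookup ⁅ a ⁆ i

  playerType-dictator : playerType i ≡ true
  playerType-dictator = []=⇒lookup (x∈⁅x⁆ i)

  playerType-dummy : ∀ {a} → a ≢ i → playerType a ≡ false
  playerType-dummy a≢i = Boolₚ.¬-not λ i∈⁅a⁆ → a≢i (sym (x∈⁅y⁆⇒x≡y _ (lookup⇒[]= i _ i∈⁅a⁆)))

  W-∪⁅⁆ : ∀ S a → W G (S ∪ ⁅ a ⁆) ≡ lookup S i ∨ playerType a
  W-∪⁅⁆ S a = trans (dictatorship _) (lookup-zipWith _∨_ i S ⁅ a ⁆)

  ≿⇔≤ : ∀ a b → AtLeastAsDesirable G a b ⇔ playerType b Bool.≤ playerType a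
  ≿⇔≤ a b = mk⇔ (≤-from-empty ∘ λ a≿b → a≿b Empty ∉⊥ ∉⊥) ≤⇒≿
    where
    open ≡-Reasoning

    W-⁅⁆ : ∀ c → W G (Empty ∪ ⁅ c ⁆) ≡ playerType c
    W-⁅⁆ c = begin
      W G (Empty ∪ ⁅ c ⁆)           ≡⟨ W-∪⁅⁆ Empty c ⟩
      lookup Empty i ∨ playerType c ≡⟨ cong (_∨ playerType c) (lookup-replicate i false) ⟩
      playerType c                  ∎

    ≤-from-empty : (W G (Empty ∪ ⁅ b ⁆) ≡ true → W G (Empty ∪ ⁅ a ⁆) ≡ true) →
                   playerType b Bool.≤ playerType a
    ≤-from-empty h with playerType b in b-type | playerType a in a-type
    ... | false | _ = Boolₚ.≤-minimum _
    ... | true | true = Boolₚ.≤-refl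
    ... | true | false
      with () ← trans (sym (h (trans (W-⁅⁆ b) b-type))) (trans (W-⁅⁆ a) a-type)

    ≤⇒≿ : playerType b Bool.≤ playerType a → AtLeastAsDesirable G a b
    ≤⇒≿ b≤a S _ _ WS∪b =
      trans (W-∪⁅⁆ S a) (∨-monoʳ (lookup S i) b≤a (trans (sym (W-∪⁅⁆ S b)) WS∪b))
      where
      ∨-monoʳ : ∀ s {x y} → x Bool.≤ y → s ∨ x ≡ true → s ∨ y ≡ true
      ∨-monoʳ true _ _ = refl
      ∨-monoʳ false Bool.b≤b sx = sx
      ∨-monoʳ false Bool.f≤t _ = refl

  ≈⇔≡ : ∀ a b → EquallyDesirable G a b ⇔ (playerType a ≡ playerType b)
  ≈⇔≡ a b = mk⇔
    (λ a≈b → Boolₚ.≤-antisym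
      (to (≿⇔≤ b a) λ S b∉S a∉S → to (a≈b S a∉S b∉S))
      (to (≿⇔≤ a b) λ S a∉S b∉S → from (a≈b S a∉S b∉S)))
    (λ a≡b S _ _ → ≡⇒true⇔true (W≡ a≡b S))
    where
    W≡ : playerType a ≡ playerType b → ∀ S → W G (S ∪ ⁅ a ⁆) ≡ W G (S ∪ ⁅ b ⁆)
    W≡ a≡b S = trans (W-∪⁅⁆ S a) (trans (cong (lookup S i ∨_) a≡b) (sym (W-∪⁅⁆ S b)))

  complete : Complete G
  complete =
    (λ a → from (≿⇔≤ a a) Boolₚ.≤-refl) ,
    (λ a b c a≿b b≿c → from (≿⇔≤ a c) (Boolₚ.≤-trans (to (≿⇔≤ b c) b≿c) (to (≿⇔≤ a b) a≿b))) ,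
    (λ a b → map (from (≿⇔≤ a b)) (from (≿⇔≤ b a)) (Boolₚ.≤-total (playerType b) (playerType a)))

dictatorTypes : ℕ → ℕ
dictatorTypes (suc (suc _)) = 2
dictatorTypes _ = 1

dictatorship-numTypes : ∀ {m} (G : SimpleGame (suc m)) {i} → Dictatorship G i →
                        NumTypes G (dictatorTypes (suc m))
dictatorship-numTypes {zero} G dictatorship =
  (λ _ → zero) , (λ { zero → zero , λ _ → refl }) ,
  λ { zero zero → mk⇔ (λ _ → refl) (λ _ → from (≈⇔≡ G dictatorship zero zero) refl) }
dictatorship-numTypes {suc m} G {i} dictatorship =
  Bijection.to Bool⤖2 ∘ type ,
  Composition.surjective _≡_ _≡_ _≡_ type-surjective (Bijection.surjective Bool⤖2) ,
  λ a b → mk⇔ (cong (Bijection.to Bool⤖2) ∘ to (≈⇔≡ G dictatorship a b))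
              (from (≈⇔≡ G dictatorship a b) ∘ Bijection.injective Bool⤖2)
  where
  type = playerType G dictatorship
  Bool⤖2 = ↔⇒⤖ (↔-sym 2↔Bool)

  type-surjective : Surjective _≡_ _≡_ type
  type-surjective true = i , λ { refl → playerType-dictator G dictatorship }
  type-surjective false =
    punchIn i zero , λ { refl → playerType-dummy G dictatorship (punchInᵢ≢i i zero) }

-- g composed with a section of f is injective.
ker⊆⇒≤ : ∀ {A : Set} {t s} {f : A → Fin t} {g : A → Fin s} → Surjective _≡_ _≡_ f →
         (∀ a b → g a ≡ g b → f a ≡ f b) → t ≤ s
ker⊆⇒≤ {f = f} {g} f-surjective ker⊆ = injective⇒≤ {f = g ∘ section} λ {k} {l} gk≡gl → begin
  k               ≡⟨ sym (f∘section k) ⟩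
  f (section k)   ≡⟨ ker⊆ _ _ gk≡gl ⟩
  f (section l)   ≡⟨ f∘section l ⟩
  l               ∎
  where
  open ≡-Reasoning
  section = proj₁ ∘ f-surjective
  f∘section : ∀ k → f (section k) ≡ k
  f∘section k = proj₂ (f-surjective k) refl

numTypes-unique : ∀ {n} {G : SimpleGame n} {t s} → NumTypes G t → NumTypes G s → t ≡ s
numTypes-unique (f , f-surjective , f-types) (g , g-surjective , g-types) = ℕ.≤-antisym
  (ker⊆⇒≤ f-surjective λ a b → to (f-types a b) ∘ from (g-types a b))
  (ker⊆⇒≤ g-surjective λ a b → to (g-types a b) ∘ from (f-types a b))

transpose-first : ∀ {n} (j k : Fin n) → PermC.transpose j k j ≡ k
transpose-first j k rewrite dec-true (j ≟ j) refl = refl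

dictatorships-isomorphic : ∀ {n} (G H : SimpleGame n) {i j} →
                           Dictatorship G i → Dictatorship H j → Isomorphic G H
dictatorships-isomorphic G H {i} {j} G-dictatorship H-dictatorship =
  Perm.transpose i j , λ S → ≡⇒true⇔true (sym (W-image S))
  where
  open ≡-Reasoning
  W-image : ∀ S → W H (image (Perm.transpose i j) S) ≡ W G S
  W-image S = begin
    W H (image (Perm.transpose i j) S)       ≡⟨ H-dictatorship _ ⟩
    lookup (image (Perm.transpose i j) S) j  ≡⟨ lookup∘tabulate _ j ⟩
    lookup S (PermC.transpose j i j)         ≡⟨ cong (lookup S) (transpose-first j i) ⟩
    lookup S i                               ≡⟨ sym (G-dictatorship S) ⟩
    W G S                                    ∎

dictatorGame : ∀ m → SimpleGame (suc m)
dictatorGame m = record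
  { W = λ S → lookup S zero
  ; full-win = refl
  ; empty-los = refl
  ; monotone = λ S T 0∈S S⊆T → []=⇒lookup (S⊆T (lookup⇒[]= zero S 0∈S))
  }

dictatorGame-dictatorship : ∀ m → Dictatorship (dictatorGame m) zero
dictatorGame-dictatorship m S = refl

dictatorGame-completeWithDictator : ∀ m → CompleteWithDictator (dictatorGame m)
dictatorGame-completeWithDictator m =
  complete (dictatorGame m) (dictatorGame-dictatorship m) ,
  zero , dictatorship⇒dictator (dictatorGame m) (dictatorGame-dictatorship m)

numIsoClasses-one : ∀ {n} (P : SimpleGame n → Set) (G₀ : SimpleGame n) → P G₀ →
                    (∀ G → P G → HasDictator G) → NumIsoClasses n P 1
numIsoClasses-one P G₀ PG₀ dictated =
  (λ _ → G₀) , (λ _ → PG₀) , (λ { zero zero _ → refl }) ,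
  λ G PG → zero , dictatorships-isomorphic G G₀ (dictatorship-of G PG) (dictatorship-of G₀ PG₀)
  where
  dictatorship-of : ∀ G (PG : P G) → Dictatorship G (proj₁ (dictated G PG))
  dictatorship-of G PG = dictator⇒dictatorship G (proj₂ (dictated G PG))

numIsoClasses-zero : ∀ {n} (P : SimpleGame n → Set) → (∀ G → ¬ P G) → NumIsoClasses n P 0
numIsoClasses-zero P ¬P = (λ ()) , (λ ()) , (λ ()) , λ G PG → contradiction PG (¬P G)

cgdValue-dictatorTypes : ∀ m → cgdValue (suc m) (dictatorTypes (suc m)) ≡ 1
cgdValue-dictatorTypes zero = refl
cgdValue-dictatorTypes (suc m) = refl

cgdValue-otherTypes : ∀ m t → 1 ≤ t → t ≢ dictatorTypes (suc m) → cgdValue (suc m) t ≡ 0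
cgdValue-otherTypes zero (suc zero) _ 1≢1 = contradiction refl 1≢1
cgdValue-otherTypes zero (suc (suc t)) _ _ = refl
cgdValue-otherTypes (suc m) (suc zero) _ _ = refl
cgdValue-otherTypes (suc m) (suc (suc zero)) _ 2≢2 = contradiction refl 2≢2
cgdValue-otherTypes (suc m) (suc (suc (suc t))) _ _ = refl

mainTheorem1 : (∀ n → 1 ≤ n → NumIsoClasses n CompleteWithDictator 1)
    × (∀ n t → 1 ≤ n → 1 ≤ t →
    NumIsoClasses n (λ G → CompleteWithDictator G × NumTypes G t) (cgdValue n t))
mainTheorem1 = cgd , cgd-types
  where
  cgd : ∀ n → 1 ≤ n → NumIsoClasses n CompleteWithDictator 1
  cgd (suc m) _ =
    numIsoClasses-one _ (dictatorGame m) (dictatorGame-completeWithDictator m) (λ _ → proj₂)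

  cgd-types : ∀ n t → 1 ≤ n → 1 ≤ t →
              NumIsoClasses n (λ G → CompleteWithDictator G × NumTypes G t) (cgdValue n t)
  cgd-types (suc m) t _ 1≤t with t ℕ.≟ dictatorTypes (suc m)
  ... | yes refl rewrite cgdValue-dictatorTypes m =
    numIsoClasses-one _ (dictatorGame m)
      (dictatorGame-completeWithDictator m ,
       dictatorship-numTypes (dictatorGame m) (dictatorGame-dictatorship m))
      (λ _ → proj₂ ∘ proj₁)
  ... | no t≢types rewrite cgdValue-otherTypes m t 1≤t t≢types =
    numIsoClasses-zero _ λ { G ((_ , _ , dictator) , G-types) →
      t≢types (numTypes-unique {G = G} G-types
                (dictatorship-numTypes G (dictator⇒dictatorship G dictator))) }
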